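{- Let $G$ be a cubic graph. Let $F$ be an orientation of $I(G)$ and let $D$ be the projection of $F$ onto $G$. If $D$ has exactly $C$ full pairs, then $F$ has at most $4C+2|V(G)|$ full pairs.
   Context: Graphs are finite and simple; cubic means $3$-regular. For a cubic graph $G$, the inflation $I(G)$ is obtained as follows: for every vertex $v$ with neighbours $x,y,z$, take a triangle $T_v$ on new vertices $v_x,v_y,v_z$; then join $v_x$ to $x_v$ for every edge $vx$ of $G$. If $F$ is an orientation of $I(G)$, its projection onto $G$ is the orientation of $G$ in which $vx$ is oriented $(v,x)$ if $(v_x,x_v)$ is an arc of $F$ and $(x,v)$ if $(x_v,v_x)$ is an arc of $F$. For a digraph $D$ and distinct vertices $u,v$, $\kappa_D(u,v)$ is the maximum number of internally disjoint directed $u$--$v$ paths, and $\theta_D(u,v)=\kappa_D(u,v)+\kappa_D(v,u)$. If $D$ is an orientation of a graph $H$, an unordered pair of distinct vertices $\{u,v\}$ is full in $D$ if $\theta_D(u,v)=\min\{\deg_H(u),\deg_H(v)\}$ (so here, full means $\theta=3$). -}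

module Defs where

open import Data.Nat using (ℕ; _+_; _⊓_)
open import Data.Bool using (Bool; true; false; _∧_; _∨_; not; T)
open import Data.Bool.Properties using (T?)
open import Data.Fin using (Fin; _≟_)
open import Data.List using (List; []; _∷_; _++_; length)
open import Data.List.Membership.Propositional using (_∈_)
open import Data.List.Relation.Unary.All using (All)
open import Data.List.Relation.Unary.Any using (Any)
open import Data.List.Relation.Unary.AllPairs using (AllPairs)
open import Data.List.Relation.Unary.Linked using (Linked)
open import Data.List.Relation.Unary.Unique.Propositional using (Unique)
open import Data.List.Relation.Binary.Disjoint.Propositional using (Disjoint)
open import Data.Product using (Σ; _×_; _,_; ∃; proj₁; proj₂)
open import Data.Sum using (_⊎_)
open import Function.Bundles using (_⇔_)
open import Relation.Nullary using (¬_; yes; no)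
open import Relation.Nullary.Decidable using (⌊_⌋)
open import Relation.Binary.PropositionalEquality using (_≡_; _≢_; subst)

HasDegree : {V : Set} → (V → V → Bool) → V → ℕ → Set
HasDegree {V} E u d =
  Σ (List V) λ L → Unique L × (∀ x → (x ∈ L) ⇔ T (E u x)) × length L ≡ d

IsOrientation : {V : Set} → (V → V → Bool) → (V → V → Bool) → Set
IsOrientation {V} E A =
  (∀ u v → T (A u v) → T (E u v)) ×
  (∀ u v → T (E u v) → (T (A u v) × ¬ T (A v u)) ⊎ (T (A v u) × ¬ T (A u v)))

record DPath {V : Set} (A : V → V → Bool) (u v : V) : Set where
  field
    mids  : List V
    uniq  : Unique (u ∷ mids ++ v ∷ [])
    walk  : Linked (λ x y → T (A x y)) (u ∷ mids ++ v ∷ [])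
open DPath public

IntDisjoint : {V : Set} {A : V → V → Bool} {u v : V} → List (DPath A u v) → Set
IntDisjoint = AllPairs (λ p q → (mids p ≢ mids q) × Disjoint (mids p) (mids q))

IsKappa : {V : Set} → (V → V → Bool) → V → V → ℕ → Set
IsKappa A u v k =
  (Σ (List (DPath A u v)) λ P → IntDisjoint P × length P ≡ k) ×
  (∀ (P : List (DPath A u v)) → IntDisjoint P → length P Data.Nat.≤ k)

Full : {V : Set} → (V → V → Bool) → (V → V → Bool) → V → V → Set
Full E A u v = (u ≢ v) ×
  Σ ℕ λ k₁ → Σ ℕ λ k₂ → Σ ℕ λ d₁ → Σ ℕ λ d₂ →
    IsKappa A u v k₁ × IsKappa A v u k₂ × HasDegree E u d₁ × HasDegree E v d₂ ×
    (k₁ + k₂ ≡ d₁ ⊓ d₂)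

SameUPair : {V : Set} → V × V → V × V → Set
SameUPair (a , b) (c , d) = (a ≡ c × b ≡ d) ⊎ (a ≡ d × b ≡ c)

FullPairList : {V : Set} → (V → V → Bool) → (V → V → Bool) → List (V × V) → Set
FullPairList E A L =
  AllPairs (λ p q → ¬ SameUPair p q) L × All (λ p → Full E A (proj₁ p) (proj₂ p)) L

ExactlyFullPairs : {V : Set} → (V → V → Bool) → (V → V → Bool) → ℕ → Set
ExactlyFullPairs {V} E A C =
  Σ (List (V × V)) λ L → FullPairList E A L ×
    (∀ u v → Full E A u v → Any (SameUPair (u , v)) L) × length L ≡ C

record SimpleGraph : Set where
  field
    n     : ℕ
    Adj   : Fin n → Fin n → Bool
    sym   : ∀ u v → Adj u v ≡ Adj v u
    irref : ∀ u → Adj u u ≡ false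
open SimpleGraph public

Cubic : SimpleGraph → Set
Cubic G = ∀ v → HasDegree (Adj G) v 3

-- Vertices of the inflation: v_x for each ordered adjacent pair (v , x).
IVert : SimpleGraph → Set
IVert G = Σ (Fin (n G)) λ v → Σ (Fin (n G)) λ x → T (Adj G v x)

-- Edges of I(G): v_x v_y for x ≠ y (triangle T_v), and v_x x_v.
IAdj : (G : SimpleGraph) → IVert G → IVert G → Bool
IAdj G (v , x , _) (w , y , _) =
  (⌊ v ≟ w ⌋ ∧ not ⌊ x ≟ y ⌋) ∨ (⌊ w ≟ x ⌋ ∧ ⌊ y ≟ v ⌋)

adj-sym : (G : SimpleGraph) {v x : Fin (n G)} → T (Adj G v x) → T (Adj G x v)
adj-sym G {v} {x} p = subst T (sym G v x) p

projection : (G : SimpleGraph) → (IVert G → IVert G → Bool) → Fin (n G) → Fin (n G) → Bool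
projection G F v x with T? (Adj G v x)
... | yes p = F (v , x , p) (x , v , adj-sym G p)
... | no _  = false

-- Every vertex of I(G) has degree 3, so for a full pair {a, b} of F the internally disjoint
-- a–b and b–a paths have to leave a and b through all of their out-neighbours:
-- κ(a, b) = d⁺(a), κ(b, a) = d⁺(b) and d⁺(a) + d⁺(b) = 3.  The out-degrees of the three
-- corners of a triangle T_v sum to 3 + d⁺_D(v).  Hence the three pairs inside T_v are never
-- all full, which gives at most 2|V(G)| full pairs inside triangles.  For a ∈ T_v and b ∈ T_w
-- with v ≠ w, contracting every triangle to a point turns internally disjoint a–b paths of F
-- into internally disjoint v–w paths of D: a path passing through T_u uses two of its three
-- corners, so two disjoint paths cannot both pass through T_u.  Therefore {v, w} is full in
-- D, d⁺(a) = d⁺_D(v) and d⁺(b) = d⁺_D(w); as at most two corners of T_v have out-degree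
-- d⁺_D(v), each of the C full pairs of D accounts for at most 4 full pairs of F.

module Submission where

open import Defs hiding (sym)
open import Data.Nat using (ℕ; _+_; _*_; _≤_)
open import Data.List using (List; length)
open import Data.Bool using (Bool)
open import Data.Product using (_×_)

open import Data.Bool using (true; false; T)
open import Data.Bool.Properties using (T-irrelevant; ∨-zeroʳ)
open import Data.Empty using (⊥; ⊥-elim)
open import Data.Fin as Fin using (Fin; zero; suc)
open import Data.Fin.Patterns using (0F; 1F; 2F)
open import Data.List using ([]; _∷_; _++_; map; filter; allFin; lookup; tabulate; cartesianProduct)
open import Data.List.Properties
  using (∷-injectiveˡ; ∷-injectiveʳ; map-++; ++-assoc; length-map; length-removeAt′; filter-notAll; length-tabulate; length-++)
open import Data.List.Membership.Propositional using (_∈_; _∉_; _─_)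
open import Data.List.Membership.Propositional.Properties
  using ( ∈-filter⁺; ∈-filter⁻; ∈-map⁻; ∈-++⁺ˡ; ∈-++⁺ʳ; ∈-++⁻; ∈-∃++; ∈-lookup; ∈-tabulate⁺; ∈-tabulate⁻
        ; ∈-allFin; ∈-cartesianProduct⁺)
open import Data.List.Relation.Binary.Disjoint.Propositional using (Disjoint)
open import Data.List.Relation.Binary.Subset.Propositional using (_⊆_)
open import Data.List.Relation.Unary.All as All using (All; []; _∷_)
open import Data.List.Relation.Unary.All.Properties as Allₚ using (¬Any⇒All¬)
open import Data.List.Relation.Unary.AllPairs as AllPairs using (AllPairs; []; _∷_)
import Data.List.Relation.Unary.AllPairs.Properties as AllPairsₚ
open import Data.List.Relation.Unary.Any as Any using (Any; here; there)
open import Data.List.Relation.Unary.Any.Properties using (lookup-index)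
open import Data.List.Relation.Unary.Linked as Linked using (Linked; []; [-]; _∷_)
open import Data.List.Relation.Unary.Unique.Propositional using (Unique)
open import Data.List.Relation.Unary.Unique.Propositional.Properties using (tabulate⁺)
open import Data.Nat as ℕ using (zero; suc; _⊓_; z≤n; s≤s)
open import Data.Nat.ListAction using (sum)
open import Data.Nat.Properties
open import Data.Nat.Tactic.RingSolver using (solve-∀)
open import Data.Product using (Σ; ∃; ∃₂; _,_; proj₁; proj₂)
open import Data.Sum using (_⊎_; inj₁; inj₂; [_,_]′)
open import Function using (_∘_; id)
open import Function.Bundles using (Equivalence; mk⇔)
open import Level using (0ℓ)
open import Relation.Binary.Definitions using (DecidableEquality)
open import Relation.Binary.PropositionalEquality
  using (_≡_; _≢_; refl; sym; trans; cong; cong₂; subst; subst₂; module ≡-Reasoning)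
open import Relation.Nullary using (¬_; Dec; yes; no; does)
open import Relation.Nullary.Decidable using (T?; _×-dec_; _⊎-dec_)
open import Relation.Unary using (Pred; Decidable; ∁)
open import Relation.Unary.Properties using (∁?)

private
  variable
    X Y : Set

∈-─⁺ : {x z : X} {xs : List X} (x∈xs : x ∈ xs) → z ∈ xs → z ≢ x → z ∈ xs ─ x∈xs
∈-─⁺ (here refl) (here refl) z≢x = ⊥-elim (z≢x refl)
∈-─⁺ (here refl) (there z∈xs) _ = z∈xs
∈-─⁺ (there x∈xs) (here refl) _ = here refl
∈-─⁺ (there x∈xs) (there z∈xs) z≢x = there (∈-─⁺ x∈xs z∈xs z≢x)

unique⊆⇒length≤ : {xs ys : List X} → Unique xs → xs ⊆ ys → length xs ≤ length ys
unique⊆⇒length≤ {xs = []} _ _ = z≤n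
unique⊆⇒length≤ {xs = x ∷ xs} {ys} (x∉xs ∷ xs!) xs⊆ys = begin
  suc (length xs)          ≤⟨ s≤s (unique⊆⇒length≤ xs! xs⊆ys─x) ⟩
  suc (length (ys ─ x∈ys)) ≡⟨ length-removeAt′ ys (Any.index x∈ys) ⟨
  length ys                ∎
  where
  open ≤-Reasoning
  x∈ys = xs⊆ys (here refl)
  xs⊆ys─x : xs ⊆ ys ─ x∈ys
  xs⊆ys─x z∈xs = ∈-─⁺ x∈ys (xs⊆ys (there z∈xs)) (All.lookup x∉xs z∈xs ∘ sym)

length≤-by-injection : (f : X → Y) {xs : List X} {ys : List Y} →
  AllPairs (λ x x′ → f x ≢ f x′) xs → (∀ {x} → x ∈ xs → f x ∈ ys) → length xs ≤ length ys
length≤-by-injection f {xs} injective into =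
  subst (_≤ _) (length-map f xs) (unique⊆⇒length≤ (AllPairsₚ.map⁺ {f = f} injective) image⊆)
  where
  image⊆ : map f xs ⊆ _
  image⊆ y∈ with _ , x∈xs , refl ← ∈-map⁻ f y∈ = into x∈xs

module _ {P : Pred X 0ℓ} (P? : Decidable P) where

  length-filter+length-filter-∁ : (xs : List X) →
    length (filter P? xs) + length (filter (∁? P?) xs) ≡ length xs
  length-filter+length-filter-∁ [] = refl
  length-filter+length-filter-∁ (x ∷ xs) with does (P? x)
  ... | true = cong suc (length-filter+length-filter-∁ xs)
  ... | false = trans (+-suc _ _) (cong suc (length-filter+length-filter-∁ xs))

  length-filter-filter : {Q : Pred X 0ℓ} (Q? : Decidable Q) (xs : List X) →
    length (filter P? (filter Q? xs)) ≤ length (filter P? xs)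
  length-filter-filter Q? [] = z≤n
  length-filter-filter Q? (x ∷ xs) with does (Q? x)
  ... | true with does (P? x)
  ...   | true = s≤s (length-filter-filter Q? xs)
  ...   | false = length-filter-filter Q? xs
  length-filter-filter Q? (x ∷ xs) | false with does (P? x)
  ...   | true = m≤n⇒m≤1+n (length-filter-filter Q? xs)
  ...   | false = length-filter-filter Q? xs

Disjoint⇒≢ : {xs ys : List X} → Disjoint xs ys → {x y : X} → x ∈ xs → y ∈ ys → x ≢ y
Disjoint⇒≢ xs#ys x∈ y∈ refl = xs#ys (x∈ , y∈)

AllPairs-restrict : {P : X → Set} {R S : X → X → Set} → (∀ {x y} → P x → P y → R x y → S x y) →
  {xs : List X} → All P xs → AllPairs R xs → AllPairs S xs
AllPairs-restrict f [] [] = []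
AllPairs-restrict f (px ∷ pxs) (Rxs ∷ Rs) = All.zipWith (λ (py , Rxy) → f px py Rxy) (pxs , Rxs) ∷ AllPairs-restrict f pxs Rs

length-cartesianProduct : (xs : List X) (ys : List Y) → length (cartesianProduct xs ys) ≡ length xs * length ys
length-cartesianProduct [] ys = refl
length-cartesianProduct (x ∷ xs) ys = begin
  length (map (x ,_) ys ++ cartesianProduct xs ys)
    ≡⟨ length-++ (map (x ,_) ys) ⟩
  length (map (x ,_) ys) + length (cartesianProduct xs ys)
    ≡⟨ cong₂ _+_ (length-map (x ,_) ys) (length-cartesianProduct xs ys) ⟩
  length ys + length xs * length ys ∎
  where open ≡-Reasoning

All-filter-filter : {R P Q : Pred X 0ℓ} (P? : Decidable P) (Q? : Decidable Q) {xs : List X} → All R xs →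
  All (λ x → R x × P x × Q x) (filter Q? (filter P? xs))
All-filter-filter P? Q? {xs} Rxs = All.map (λ ((r , p) , q) → r , p , q)
  (All.zip (Allₚ.filter⁺ Q? (All.zip (Allₚ.filter⁺ P? Rxs , Allₚ.all-filter P? xs)) , Allₚ.all-filter Q? (filter P? xs)))

length≤-by-cover : (R : X → Y → Set) (R? : ∀ x y → Dec (R x y)) (k : ℕ)
  (ys : List Y) (xs : List X) → (∀ {x} → x ∈ xs → Any (R x) ys) →
  (∀ y → length (filter (λ x → R? x y) xs) ≤ k) → length xs ≤ length ys * k
length≤-by-cover R R? k [] [] covered fibre = z≤n
length≤-by-cover R R? k [] (x ∷ xs) covered fibre with () ← covered (here refl)
length≤-by-cover R R? k (y ∷ ys) xs covered fibre = begin
  length xs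
    ≡⟨ length-filter+length-filter-∁ (λ x → R? x y) xs ⟨
  length (filter (λ x → R? x y) xs) + length rest
    ≤⟨ +-mono-≤ (fibre y) (length≤-by-cover R R? k ys rest covered′ fibre′) ⟩
  k + length ys * k ∎
  where
  open ≤-Reasoning
  rest = filter (∁? (λ x → R? x y)) xs
  covered′ : ∀ {x} → x ∈ rest → Any (R x) ys
  covered′ x∈rest with ∈-filter⁻ (∁? (λ x → R? x y)) x∈rest
  ... | x∈xs , ¬Rxy with covered x∈xs
  ... | here Rxy = ⊥-elim (¬Rxy Rxy)
  ... | there Rxys = Rxys
  fibre′ : ∀ y′ → length (filter (λ x → R? x y′) rest) ≤ k
  fibre′ y′ = ≤-trans (length-filter-filter (λ x → R? x y′) (∁? (λ x → R? x y)) xs) (fibre y′)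

indicator : Bool → ℕ
indicator true = 1
indicator false = 0

length-filter-T? : (g : X → Bool) (xs : List X) → length (filter (T? ∘ g) xs) ≡ sum (map (indicator ∘ g) xs)
length-filter-T? g [] = refl
length-filter-T? g (x ∷ xs) with g x
... | true = cong suc (length-filter-T? g xs)
... | false = length-filter-T? g xs

headOr : X → List X → X
headOr y [] = y
headOr y (m ∷ _) = m

lastOf : X → List X → X
lastOf x [] = x
lastOf x (m ∷ ms) = lastOf m ms

headOr-cases : (y : X) (ms : List X) → (ms ≡ [] × headOr y ms ≡ y) ⊎ headOr y ms ∈ ms
headOr-cases y [] = inj₁ (refl , refl)
headOr-cases y (m ∷ ms) = inj₂ (here refl)

lastOf-cases : (x : X) (ms : List X) → (ms ≡ [] × lastOf x ms ≡ x) ⊎ lastOf x ms ∈ ms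
lastOf-cases x [] = inj₁ (refl , refl)
lastOf-cases x (m ∷ ms) with lastOf-cases m ms
... | inj₁ (refl , refl) = inj₂ (here refl)
... | inj₂ ∈ms = inj₂ (there ∈ms)

lastOf-∈ : (x : X) (ms : List X) → lastOf x ms ∈ x ∷ ms
lastOf-∈ x [] = here refl
lastOf-∈ x (m ∷ ms) = there (lastOf-∈ m ms)

headOr-∈ : (y : X) (ms : List X) → headOr y ms ∈ ms ++ y ∷ []
headOr-∈ y [] = here refl
headOr-∈ y (m ∷ ms) = here refl

module _ {R : X → X → Set} where

  Linked-lastOf : (x : X) (ms : List X) {c : X} {ys : List X} →
    Linked R (x ∷ ms ++ c ∷ ys) → R (lastOf x ms) c
  Linked-lastOf x [] xs~ = Linked.head xs~
  Linked-lastOf x (m ∷ ms) xs~ = Linked-lastOf m ms (Linked.tail xs~)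

  Linked-headOr : (xs ms : List X) {c y : X} →
    Linked R (xs ++ c ∷ ms ++ y ∷ []) → R c (headOr y ms)
  Linked-headOr [] [] xs~ = Linked.head xs~
  Linked-headOr [] (m ∷ ms) xs~ = Linked.head xs~
  Linked-headOr (x ∷ xs) ms xs~ = Linked-headOr xs ms (Linked.tail xs~)

Unique-++⇒disjoint : (xs : List X) {ys : List X} {x y : X} → Unique (xs ++ ys) → x ∈ xs → y ∈ ys → x ≢ y
Unique-++⇒disjoint (_ ∷ xs) (x∉ ∷ _) (here refl) y∈ys = All.lookup x∉ (∈-++⁺ʳ xs y∈ys)
Unique-++⇒disjoint (_ ∷ xs) (_ ∷ xs!) (there x∈xs) y∈ys = Unique-++⇒disjoint xs xs! x∈xs y∈ys

Unique-lookup-injective : {xs : List X} → Unique xs → {i j : Fin (length xs)} → lookup xs i ≡ lookup xs j → i ≡ j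
Unique-lookup-injective (_ ∷ _) {zero} {zero} _ = refl
Unique-lookup-injective (x∉ ∷ _) {zero} {suc j} eq = ⊥-elim (All.lookup x∉ (∈-lookup j) eq)
Unique-lookup-injective (x∉ ∷ _) {suc i} {zero} eq = ⊥-elim (All.lookup x∉ (∈-lookup i) (sym eq))
Unique-lookup-injective (_ ∷ xs!) {suc i} {suc j} eq = cong suc (Unique-lookup-injective xs! eq)

Linked-≢ : {R : X → X → Set} {xs : List X} → Unique xs → Linked R xs → Linked (λ x y → R x y × x ≢ y) xs
Linked-≢ _ [] = []
Linked-≢ _ [-] = [-]
Linked-≢ ((x≢y ∷ _) ∷ xs!) (Rxy ∷ xs~) = (Rxy , x≢y) ∷ Linked-≢ xs! xs~

data Consecutive {X : Set} : List X → X → X → Set where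
  start : {x y : X} {zs : List X} → Consecutive (x ∷ y ∷ zs) x y
  skip : {z x y : X} {zs : List X} → Consecutive zs x y → Consecutive (z ∷ zs) x y

module _ {x y : X} where

  Consecutive-∈ˡ : {zs : List X} → Consecutive zs x y → x ∈ zs
  Consecutive-∈ˡ start = here refl
  Consecutive-∈ˡ (skip xy) = there (Consecutive-∈ˡ xy)

  Consecutive-∈ʳ : {zs : List X} → Consecutive zs x y → y ∈ zs
  Consecutive-∈ʳ start = there (here refl)
  Consecutive-∈ʳ (skip xy) = there (Consecutive-∈ʳ xy)

  Linked⇒Consecutive⇒ : {R : X → X → Set} {zs : List X} → Linked R zs → Consecutive zs x y → R x y
  Linked⇒Consecutive⇒ (Rxy ∷ _) start = Rxy
  Linked⇒Consecutive⇒ (_ ∷ zs~) (skip xy) = Linked⇒Consecutive⇒ zs~ xy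

ImageStep : (X → Y) → List X → Y → Y → Set
ImageStep {X} f xs y y′ = Σ X λ x → Σ X λ x′ → Consecutive xs x x′ × f x ≡ y × f x′ ≡ y′

Linked-ImageStep : (f : X → Y) (xs : List X) → Linked (ImageStep f xs) (map f xs)
Linked-ImageStep f [] = []
Linked-ImageStep f (x ∷ []) = [-]
Linked-ImageStep f (x ∷ x′ ∷ xs) =
  (x , x′ , start , refl , refl) ∷
  Linked.map (λ (z , z′ , zz′ , eq , eq′) → z , z′ , skip zz′ , eq , eq′) (Linked-ImageStep f (x′ ∷ xs))

SameUPair-sym : {p q : X × X} → SameUPair p q → SameUPair q p
SameUPair-sym (inj₁ (refl , refl)) = inj₁ (refl , refl)
SameUPair-sym (inj₂ (refl , refl)) = inj₂ (refl , refl)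

SameUPair-trans : {p q r : X × X} → SameUPair p q → SameUPair q r → SameUPair p r
SameUPair-trans (inj₁ (refl , refl)) q~r = q~r
SameUPair-trans (inj₂ (refl , refl)) (inj₁ (refl , refl)) = inj₂ (refl , refl)
SameUPair-trans (inj₂ (refl , refl)) (inj₂ (refl , refl)) = inj₁ (refl , refl)

SameUPair-both : {P : X → Set} {p q : X × X} → SameUPair p q →
  P (proj₁ p) → P (proj₂ p) → P (proj₁ q) × P (proj₂ q)
SameUPair-both (inj₁ (refl , refl)) P₁ P₂ = P₁ , P₂
SameUPair-both (inj₂ (refl , refl)) P₁ P₂ = P₂ , P₁

SameUPair? : DecidableEquality X → (p q : X × X) → Dec (SameUPair p q)
SameUPair? _≟_ (a , b) (c , d) = ((a ≟ c) ×-dec (b ≟ d)) ⊎-dec ((a ≟ d) ×-dec (b ≟ c))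

-- Loop erasure

module LoopErasure {X : Set} (_≟_ : DecidableEquality X) where

  open import Data.List.Membership.DecPropositional _≟_ using (_∈?_)

  suffixAt : {x : X} {xs : List X} → x ∈ xs → List X
  suffixAt {xs = xs} (here _) = xs
  suffixAt (there x∈xs) = suffixAt x∈xs

  loopErase : List X → List X
  loopErase [] = []
  loopErase (x ∷ xs) with x ∈? loopErase xs
  ... | yes x∈ = suffixAt x∈
  ... | no _ = x ∷ loopErase xs

  module _ {x : X} where

    suffixAt-head : {xs : List X} (x∈xs : x ∈ xs) → ∃ λ t → suffixAt x∈xs ≡ x ∷ t
    suffixAt-head (here refl) = _ , refl
    suffixAt-head (there x∈xs) = suffixAt-head x∈xs

    suffixAt-⊆ : {xs : List X} (x∈xs : x ∈ xs) → suffixAt x∈xs ⊆ xs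
    suffixAt-⊆ (here _) z∈ = z∈
    suffixAt-⊆ (there x∈xs) z∈ = there (suffixAt-⊆ x∈xs z∈)

    suffixAt-unique : {xs : List X} (x∈xs : x ∈ xs) → Unique xs → Unique (suffixAt x∈xs)
    suffixAt-unique (here _) xs! = xs!
    suffixAt-unique (there x∈xs) (_ ∷ xs!) = suffixAt-unique x∈xs xs!

    suffixAt-linked : {R : X → X → Set} {xs : List X} (x∈xs : x ∈ xs) → Linked R xs → Linked R (suffixAt x∈xs)
    suffixAt-linked (here _) xs~ = xs~
    suffixAt-linked (there x∈xs) xs~ = suffixAt-linked x∈xs (Linked.tail xs~)

    suffixAt-last : {w : X} {xs ys : List X} (x∈xs : x ∈ xs) → xs ≡ ys ++ w ∷ [] →
      ∃ λ ys′ → suffixAt x∈xs ≡ ys′ ++ w ∷ []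
    suffixAt-last (here _) eq = _ , eq
    suffixAt-last {ys = []} (there ()) refl
    suffixAt-last {ys = _ ∷ _} (there x∈xs) eq = suffixAt-last x∈xs (∷-injectiveʳ eq)

  loopErase-head : (x : X) (xs : List X) → ∃ λ t → loopErase (x ∷ xs) ≡ x ∷ t
  loopErase-head x xs with x ∈? loopErase xs
  ... | yes x∈ = suffixAt-head x∈
  ... | no _ = loopErase xs , refl

  loopErase-⊆ : (xs : List X) → loopErase xs ⊆ xs
  loopErase-⊆ (x ∷ xs) z∈ with x ∈? loopErase xs
  ... | yes x∈ = there (loopErase-⊆ xs (suffixAt-⊆ x∈ z∈))
  loopErase-⊆ (x ∷ xs) (here z≡x) | no _ = here z≡x
  loopErase-⊆ (x ∷ xs) (there z∈) | no _ = there (loopErase-⊆ xs z∈)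

  loopErase-unique : (xs : List X) → Unique (loopErase xs)
  loopErase-unique [] = []
  loopErase-unique (x ∷ xs) with x ∈? loopErase xs
  ... | yes x∈ = suffixAt-unique x∈ (loopErase-unique xs)
  ... | no x∉ = ¬Any⇒All¬ _ x∉ ∷ loopErase-unique xs

  loopErase-linked : {R : X → X → Set} (xs : List X) → Linked R xs → Linked R (loopErase xs)
  loopErase-linked [] _ = []
  loopErase-linked (x ∷ []) _ = [-]
  loopErase-linked {R} (x ∷ y ∷ ys) (Rxy ∷ ys~) with x ∈? loopErase (y ∷ ys)
  ... | yes x∈ = suffixAt-linked x∈ (loopErase-linked (y ∷ ys) ys~)
  ... | no _ with t , eq ← loopErase-head y ys =
    subst (λ zs → Linked R (x ∷ zs)) (sym eq) (Rxy ∷ subst (Linked R) eq (loopErase-linked (y ∷ ys) ys~))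

  loopErase-last : {w : X} (xs ys : List X) → xs ≡ ys ++ w ∷ [] →
    ∃ λ ys′ → loopErase xs ≡ ys′ ++ w ∷ []
  loopErase-last (x ∷ []) [] refl = [] , refl
  loopErase-last (x ∷ []) (_ ∷ []) ()
  loopErase-last (x ∷ []) (_ ∷ _ ∷ _) ()
  loopErase-last (x ∷ xs@(_ ∷ _)) (_ ∷ ys) eq with x ∈? loopErase xs
  ... | yes x∈ = suffixAt-last x∈ (proj₂ (loopErase-last xs ys (∷-injectiveʳ eq)))
  ... | no _ with ys′ , eq′ ← loopErase-last xs ys (∷-injectiveʳ eq) = x ∷ ys′ , cong (x ∷_) eq′

+-tightˡ : {x y o i : ℕ} → x ≤ o → y ≤ i → x + y ≡ o + i → x ≡ o
+-tightˡ {x} {y} {o} {i} x≤o y≤i eq = ≤-antisym x≤o (+-cancelʳ-≤ i o x (begin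
  o + i ≡⟨ eq ⟨
  x + y ≤⟨ +-monoʳ-≤ x y≤i ⟩
  x + i ∎))
  where open ≤-Reasoning

double≢3 : (k : ℕ) → k + k ≢ 3
double≢3 0 ()
double≢3 1 ()
double≢3 (suc (suc k)) eq with s≤s (s≤s (s≤s ())) ← subst (4 ≤_) eq (+-mono-≤ (m≤m+n 2 k) (m≤m+n 2 k))

three-pair-sums≢3 : (x y z : ℕ) → x + y ≡ 3 → x + z ≡ 3 → y + z ≡ 3 → ⊥
three-pair-sums≢3 x y z xy xz yz with refl ← +-cancelˡ-≡ x y z (trans xy (sym xz)) = double≢3 y yz

triple≢3+ : (k : ℕ) → k + k + k ≢ 3 + k
triple≢3+ k eq = double≢3 k (+-cancelʳ-≡ k (k + k) 3 eq)

others : Fin 3 → Fin 3 × Fin 3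
others 0F = 1F , 2F
others 1F = 0F , 2F
others 2F = 0F , 1F

-- The index other than i and j; the value for i ≡ j is junk.
third : Fin 3 → Fin 3 → Fin 3
third 0F 1F = 2F
third 1F 0F = 2F
third 0F 2F = 1F
third 2F 0F = 1F
third _  _  = 0F

third-others : (i j : Fin 3) → i ≢ j → SameUPair (i , j) (others (third i j))
third-others 0F 0F i≢j = ⊥-elim (i≢j refl)
third-others 1F 1F i≢j = ⊥-elim (i≢j refl)
third-others 2F 2F i≢j = ⊥-elim (i≢j refl)
third-others 0F 1F _ = inj₁ (refl , refl)
third-others 0F 2F _ = inj₁ (refl , refl)
third-others 1F 2F _ = inj₁ (refl , refl)
third-others 1F 0F _ = inj₂ (refl , refl)
third-others 2F 0F _ = inj₂ (refl , refl)
third-others 2F 1F _ = inj₂ (refl , refl)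

others-≢ˡ : (i : Fin 3) → proj₁ (others i) ≢ i
others-≢ˡ 0F ()
others-≢ˡ 1F ()
others-≢ˡ 2F ()

others-≢ʳ : (i : Fin 3) → proj₂ (others i) ≢ i
others-≢ʳ 0F ()
others-≢ʳ 1F ()
others-≢ʳ 2F ()

others-≢ : (i : Fin 3) → proj₁ (others i) ≢ proj₂ (others i)
others-≢ 0F ()
others-≢ 1F ()
others-≢ 2F ()

others-complete : (i j : Fin 3) → j ≢ i → j ≡ proj₁ (others i) ⊎ j ≡ proj₂ (others i)
others-complete 0F 0F j≢i = ⊥-elim (j≢i refl)
others-complete 0F 1F _ = inj₁ refl
others-complete 0F 2F _ = inj₂ refl
others-complete 1F 0F _ = inj₁ refl
others-complete 1F 1F j≢i = ⊥-elim (j≢i refl)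
others-complete 1F 2F _ = inj₂ refl
others-complete 2F 0F _ = inj₁ refl
others-complete 2F 1F _ = inj₂ refl
others-complete 2F 2F j≢i = ⊥-elim (j≢i refl)

length-filter-allFin3≤2 : {P : Pred (Fin 3) 0ℓ} (P? : Decidable P) →
  ¬ (P 0F × P 1F × P 2F) → length (filter P? (allFin 3)) ≤ 2
length-filter-allFin3≤2 {P} P? not-all = ≤-pred (filter-notAll P? (allFin 3) some-fails)
  where
  some-fails : Any (∁ P) (allFin 3)
  some-fails with P? 0F | P? 1F | P? 2F
  ... | no ¬p | _ | _ = here ¬p
  ... | yes _ | no ¬q | _ = there (here ¬q)
  ... | yes _ | yes _ | no ¬r = there (there (here ¬r))
  ... | yes p | yes q | yes r = ⊥-elim (not-all (p , q , r))

-- Paths in a digraph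

module _ {V : Set} {A : V → V → Bool} {u v : V} where

  vertices : DPath A u v → List V
  vertices P = u ∷ mids P ++ v ∷ []

  source∉mids : (P : DPath A u v) → u ∉ mids P
  source∉mids P u∈ with u∉ ∷ _ ← uniq P = All.lookup u∉ (∈-++⁺ˡ u∈) refl

  target∉mids : (P : DPath A u v) → v ∉ mids P
  target∉mids P v∈ with _ ∷ rest! ← uniq P = Unique-++⇒disjoint (mids P) rest! v∈ (here refl) refl

  ∈-vertices⁻ : (P : DPath A u v) {c : V} → c ∈ vertices P → c ≡ u ⊎ c ∈ mids P ⊎ c ≡ v
  ∈-vertices⁻ P (here c≡u) = inj₁ c≡u
  ∈-vertices⁻ P (there c∈) with ∈-++⁻ (mids P) c∈
  ... | inj₁ c∈mids = inj₂ (inj₁ c∈mids)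
  ... | inj₂ (here c≡v) = inj₂ (inj₂ c≡v)

  direct-step⇒mids≡[] : (P : DPath A u v) → Consecutive (vertices P) u v → mids P ≡ []
  direct-step⇒mids≡[] P uv with mids P | uniq P
  ... | [] | _ = refl
  ... | m ∷ ms | u∉ ∷ m∉ ∷ _ with uv
  ...   | start = ⊥-elim (All.lookup m∉ (∈-++⁺ʳ ms (here refl)) refl)
  ...   | skip uv′ = ⊥-elim (All.lookup u∉ (Consecutive-∈ˡ uv′) refl)

  shared-vertex : (P Q : DPath A u v) → Disjoint (mids P) (mids Q) →
    {c : V} → c ∈ vertices P → c ∈ vertices Q → c ≡ u ⊎ c ≡ v
  shared-vertex P Q P#Q c∈P c∈Q with ∈-vertices⁻ P c∈P | ∈-vertices⁻ Q c∈Q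
  ... | inj₁ c≡u | _ = inj₁ c≡u
  ... | inj₂ (inj₂ c≡v) | _ = inj₂ c≡v
  ... | inj₂ (inj₁ _) | inj₁ c≡u = inj₁ c≡u
  ... | inj₂ (inj₁ _) | inj₂ (inj₂ c≡v) = inj₂ c≡v
  ... | inj₂ (inj₁ c∈P) | inj₂ (inj₁ c∈Q) = ⊥-elim (P#Q (c∈P , c∈Q))

  second penultimate : DPath A u v → V
  second P = headOr v (mids P)
  penultimate P = lastOf u (mids P)

  second-arc : (P : DPath A u v) → T (A u (second P))
  second-arc P = Linked-headOr [] (mids P) (walk P)

  penultimate-arc : (P : DPath A u v) → T (A (penultimate P) v)
  penultimate-arc P = Linked-lastOf u (mids P) (walk P)

  module _ (P Q : DPath A u v) (P≉Q : (mids P ≢ mids Q) × Disjoint (mids P) (mids Q)) where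

    second-injective : second P ≢ second Q
    second-injective eq with headOr-cases v (mids P) | headOr-cases v (mids Q)
    ... | inj₁ (P[] , _) | inj₁ (Q[] , _) = proj₁ P≉Q (trans P[] (sym Q[]))
    ... | inj₁ (_ , sP≡v) | inj₂ sQ∈ = target∉mids Q (subst (_∈ mids Q) (trans (sym eq) sP≡v) sQ∈)
    ... | inj₂ sP∈ | inj₁ (_ , sQ≡v) = target∉mids P (subst (_∈ mids P) (trans eq sQ≡v) sP∈)
    ... | inj₂ sP∈ | inj₂ sQ∈ = proj₂ P≉Q (sP∈ , subst (_∈ mids Q) (sym eq) sQ∈)

    penultimate-injective : penultimate P ≢ penultimate Q
    penultimate-injective eq with lastOf-cases u (mids P) | lastOf-cases u (mids Q)
    ... | inj₁ (P[] , _) | inj₁ (Q[] , _) = proj₁ P≉Q (trans P[] (sym Q[]))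
    ... | inj₁ (_ , pP≡u) | inj₂ pQ∈ = source∉mids Q (subst (_∈ mids Q) (trans (sym eq) pP≡u) pQ∈)
    ... | inj₂ pP∈ | inj₁ (_ , pQ≡u) = source∉mids P (subst (_∈ mids P) (trans eq pQ≡u) pP∈)
    ... | inj₂ pP∈ | inj₂ pQ∈ = proj₂ P≉Q (pP∈ , subst (_∈ mids Q) (sym eq) pQ∈)

  module _ {Q : Pred V 0ℓ} (Q? : Decidable Q) (L : List V) where

    κ≤out : (∀ {x} → T (A u x) → x ∈ L × Q x) →
      {Ps : List (DPath A u v)} → IntDisjoint Ps → length Ps ≤ length (filter Q? L)
    κ≤out out⊆ Ps# = length≤-by-injection second (AllPairs.map (λ {P} {P′} → second-injective P P′) Ps#)
      λ {P} _ → let (s∈L , Qs) = out⊆ (second-arc P) in ∈-filter⁺ Q? s∈L Qs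

    κ≤in : (∀ {x} → T (A x v) → x ∈ L × Q x) →
      {Ps : List (DPath A u v)} → IntDisjoint Ps → length Ps ≤ length (filter Q? L)
    κ≤in in⊆ Ps# = length≤-by-injection penultimate (AllPairs.map (λ {P} {P′} → penultimate-injective P P′) Ps#)
      λ {P} _ → let (p∈L , Qp) = in⊆ (penultimate-arc P) in ∈-filter⁺ Q? p∈L Qp

  record InteriorStep (P : DPath A u v) (c : V) : Set where
    field
      pred succ : V
      pred∈ : pred ≡ u ⊎ pred ∈ mids P
      succ∈ : succ ∈ mids P ⊎ succ ≡ v
      pred-arc : T (A pred c)
      succ-arc : T (A c succ)
      pred≢succ : pred ≢ succ

  interior-step : (P : DPath A u v) {c : V} → c ∈ mids P → InteriorStep P c
  interior-step P {c} c∈ with ms₁ , ms₂ , eq ← ∈-∃++ c∈ = record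
    { pred = lastOf u ms₁
    ; succ = headOr v ms₂
    ; pred∈ = [ inj₁ ∘ proj₂ , inj₂ ∘ ∈ms₁ ]′ (lastOf-cases u ms₁)
    ; succ∈ = [ inj₂ ∘ proj₂ , inj₁ ∘ ∈ms₂ ]′ (headOr-cases v ms₂)
    ; pred-arc = Linked-lastOf u ms₁ walk′
    ; succ-arc = Linked-headOr (u ∷ ms₁) ms₂ walk′
    ; pred≢succ = Unique-++⇒disjoint (u ∷ ms₁) uniq′ (lastOf-∈ u ms₁) (there (headOr-∈ v ms₂))
    }
    where
    split : vertices P ≡ (u ∷ ms₁) ++ c ∷ ms₂ ++ v ∷ []
    split = trans (cong (λ ms → u ∷ ms ++ v ∷ []) eq) (cong (u ∷_) (++-assoc ms₁ (c ∷ ms₂) (v ∷ [])))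
    walk′ = subst (Linked (λ x y → T (A x y))) split (walk P)
    uniq′ = subst Unique split (uniq P)
    ∈ms₁ : ∀ {x} → x ∈ ms₁ → x ∈ mids P
    ∈ms₁ x∈ = subst (_ ∈_) (sym eq) (∈-++⁺ˡ x∈)
    ∈ms₂ : ∀ {x} → x ∈ ms₂ → x ∈ mids P
    ∈ms₂ x∈ = subst (_ ∈_) (sym eq) (∈-++⁺ʳ ms₁ (there x∈))

module _ {V : Set} {E : V → V → Bool} {u : V} where

  HasDegree-unique : {d d′ : ℕ} → HasDegree E u d → HasDegree E u d′ → d ≡ d′
  HasDegree-unique (L , L! , L⇔ , refl) (L′ , L′! , L′⇔ , refl) = ≤-antisym
    (unique⊆⇒length≤ L! λ {x} x∈ → Equivalence.from (L′⇔ x) (Equivalence.to (L⇔ x) x∈))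
    (unique⊆⇒length≤ L′! λ {x} x∈ → Equivalence.from (L⇔ x) (Equivalence.to (L′⇔ x) x∈))

record Neighbours {V : Set} (E : V → V → Bool) (u : V) (d : ℕ) : Set where
  field
    nbr : Fin d → V
    nbr-adj : (i : Fin d) → T (E u (nbr i))
    nbr-injective : {i j : Fin d} → nbr i ≡ nbr j → i ≡ j
    nbr-complete : {x : V} → T (E u x) → ∃ λ i → nbr i ≡ x

module _ {V : Set} {E : V → V → Bool} {u : V} {d : ℕ} where

  HasDegree⇒Neighbours : HasDegree E u d → Neighbours E u d
  HasDegree⇒Neighbours (L , L! , L⇔ , refl) = record
    { nbr = lookup L
    ; nbr-adj = λ i → Equivalence.to (L⇔ _) (∈-lookup i)
    ; nbr-injective = Unique-lookup-injective L!
    ; nbr-complete = λ ux → let x∈L = Equivalence.from (L⇔ _) ux in Any.index x∈L , sym (lookup-index x∈L)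
    }

  Neighbours⇒HasDegree : Neighbours E u d → HasDegree E u d
  Neighbours⇒HasDegree N = tabulate nbr , tabulate⁺ nbr-injective
    , (λ x → mk⇔ (λ x∈ → let (i , x≡) = ∈-tabulate⁻ x∈ in subst (T ∘ E u) (sym x≡) (nbr-adj i))
                 (λ ux → let (i , nbr≡x) = nbr-complete ux in subst (_∈ tabulate nbr) nbr≡x (∈-tabulate⁺ i)))
    , length-tabulate nbr
    where open Neighbours N

module Orientation {V : Set} {E A : V → V → Bool} (orientation : IsOrientation E A)
  (E-sym : ∀ {x y} → T (E x y) → T (E y x)) where

  arc⇒edge : {x y : V} → T (A x y) → T (E x y)
  arc⇒edge = proj₁ orientation _ _

  arc⇒¬reverse : {x y : V} → T (A x y) → ¬ T (A y x)
  arc⇒¬reverse {x} {y} xy with proj₂ orientation x y (arc⇒edge xy)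
  ... | inj₁ (_ , ¬yx) = ¬yx
  ... | inj₂ (_ , ¬xy) = ⊥-elim (¬xy xy)

  arc-indicators : {x y : V} → T (E x y) → indicator (A x y) + indicator (A y x) ≡ 1
  arc-indicators {x} {y} xy with A x y | A y x | proj₂ orientation x y xy
  ... | true | false | _ = refl
  ... | false | true | _ = refl
  ... | true | true | inj₁ (_ , ¬yx) = ⊥-elim (¬yx _)
  ... | true | true | inj₂ (_ , ¬xy) = ⊥-elim (¬xy _)
  ... | false | false | inj₁ (() , _)
  ... | false | false | inj₂ (() , _)

  outdeg : {u : V} {d : ℕ} → HasDegree E u d → ℕ
  outdeg {u} (L , _) = length (filter (λ x → T? (A u x)) L)

  record Linkage (u v : V) (d : ℕ) : Set where
    field
      forward : List (DPath A u v)
      backward : List (DPath A v u)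
      forward# : IntDisjoint forward
      backward# : IntDisjoint backward
      total : length forward + length backward ≡ d

  open Linkage public

  Linkage-swap : {u v : V} {d : ℕ} → Linkage u v d → Linkage v u d
  Linkage-swap ℒ = record
    { forward = backward ℒ ; backward = forward ℒ ; forward# = backward# ℒ ; backward# = forward# ℒ
    ; total = trans (+-comm (length (backward ℒ)) (length (forward ℒ))) (total ℒ) }

  module _ {u : V} {d : ℕ} (hu : HasDegree E u d) where

    private
      out? = λ x → T? (A u x)
      L = proj₁ hu
      E⇒∈ : {x : V} → T (E u x) → x ∈ L
      E⇒∈ {x} = Equivalence.from (proj₁ (proj₂ (proj₂ hu)) x)

    κ≤outdeg : {v : V} {Ps : List (DPath A u v)} → IntDisjoint Ps → length Ps ≤ outdeg hu
    κ≤outdeg = κ≤out out? L λ ux → E⇒∈ (arc⇒edge ux) , ux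

    κ≤indeg : {v : V} {Qs : List (DPath A v u)} → IntDisjoint Qs → length Qs ≤ length (filter (∁? out?) L)
    κ≤indeg = κ≤in (∁? out?) L λ xu → E⇒∈ (E-sym (arc⇒edge xu)) , arc⇒¬reverse xu

    -- The in-neighbours of u are exactly the neighbours that are not out-neighbours, so a
    -- linkage of total size deg u must use every out-neighbour of u.
    Linkage-outdeg : {v : V} (ℒ : Linkage u v d) → length (forward ℒ) ≡ outdeg hu
    Linkage-outdeg ℒ = +-tightˡ (κ≤outdeg (forward# ℒ)) (κ≤indeg (backward# ℒ))
      (trans (total ℒ) (sym (trans (length-filter+length-filter-∁ out? L) (proj₂ (proj₂ (proj₂ hu))))))

  module _ {u v : V} {d : ℕ} (hu : HasDegree E u d) (hv : HasDegree E v d) where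

    Full⇒Linkage : Full E A u v → Linkage u v d
    Full⇒Linkage (_ , k₁ , k₂ , d₁ , d₂ , ((Ps , Ps# , refl) , _) , ((Qs , Qs# , refl) , _) , hu′ , hv′ , sum) =
      record { forward = Ps ; backward = Qs ; forward# = Ps# ; backward# = Qs# ; total = begin
        length Ps + length Qs ≡⟨ sum ⟩
        d₁ ⊓ d₂ ≡⟨ cong₂ _⊓_ (HasDegree-unique {E = E} hu′ hu) (HasDegree-unique {E = E} hv′ hv) ⟩
        d ⊓ d ≡⟨ ⊓-idem d ⟩
        d ∎ }
      where open ≡-Reasoning

    Linkage⇒Full : u ≢ v → Linkage u v d → Full E A u v
    Linkage⇒Full u≢v ℒ = u≢v , _ , _ , d , d
      , ((forward ℒ , forward# ℒ , refl) , λ Ps Ps# →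
          subst (length Ps ≤_) (sym (Linkage-outdeg hu ℒ)) (κ≤outdeg hu Ps#))
      , ((backward ℒ , backward# ℒ , refl) , λ Qs Qs# →
          subst (length Qs ≤_) (sym (Linkage-outdeg hv (Linkage-swap ℒ))) (κ≤outdeg hv Qs#))
      , hu , hv , trans (total ℒ) (sym (⊓-idem d))

    Full⇒outdeg-sum : Full E A u v → outdeg hu + outdeg hv ≡ d
    Full⇒outdeg-sum full = begin
      outdeg hu + outdeg hv ≡⟨ cong₂ _+_ (Linkage-outdeg hu ℒ) (Linkage-outdeg hv (Linkage-swap ℒ)) ⟨
      length (forward ℒ) + length (backward ℒ) ≡⟨ total ℒ ⟩
      d ∎
      where
      open ≡-Reasoning
      ℒ = Full⇒Linkage full

-- A path of A becomes a path of B after contracting each fibre of f to a point: the image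
-- of the vertex sequence is a walk (up to repetitions), and loop erasure makes it a path.
module Contraction {V W : Set} (_≟_ : DecidableEquality W) {A : V → V → Bool} {B : W → W → Bool}
  (f : V → W) (arc : ∀ {x y} → T (A x y) → f x ≢ f y → T (B (f x) (f y)))
  {a b : V} (fa≢fb : f a ≢ f b) (P : DPath A a b) where

  open LoopErasure _≟_

  private
    image = map f (vertices P)
    erased = loopErase image

    shape : ∃ λ ms → erased ≡ f a ∷ ms ++ f b ∷ []
    shape with t , eq₁ ← loopErase-head (f a) (map f (mids P ++ b ∷ []))
         | s , eq₂ ← loopErase-last image (f a ∷ map f (mids P)) (cong (f a ∷_) (map-++ f (mids P) (b ∷ [])))
         with s | trans (sym eq₁) eq₂
    ... | [] | eq = ⊥-elim (fa≢fb (∷-injectiveˡ eq))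
    ... | _ ∷ ms | eq = ms , trans eq₁ (cong (f a ∷_) (∷-injectiveʳ eq))

    step⇒arc : {x y : W} → ImageStep f (vertices P) x y × x ≢ y → T (B x y)
    step⇒arc ((c , c′ , cc′ , refl , refl) , x≢y) = arc (Linked⇒Consecutive⇒ (walk P) cc′) x≢y

  contract : DPath B (f a) (f b)
  contract = record
    { mids = proj₁ shape
    ; uniq = subst Unique (proj₂ shape) (loopErase-unique image)
    ; walk = subst (Linked _) (proj₂ shape)
        (Linked.map step⇒arc (Linked-≢ (loopErase-unique image) (loopErase-linked image (Linked-ImageStep f (vertices P)))))
    }

  contract-mids⊆ : mids contract ⊆ map f (vertices P)
  contract-mids⊆ x∈ = loopErase-⊆ image (subst (_ ∈_) (sym (proj₂ shape)) (there (∈-++⁺ˡ x∈)))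

  contract-direct : mids contract ≡ [] → ImageStep f (vertices P) (f a) (f b)
  contract-direct mids≡[] =
    Linked.head (subst (Linked (ImageStep f (vertices P)))
      (trans (proj₂ shape) (cong (λ ms → f a ∷ ms ++ f b ∷ []) mids≡[]))
      (loopErase-linked image (Linked-ImageStep f (vertices P))))

-- The inflation of a cubic graph

module Inflation (G : SimpleGraph) (cubic : Cubic G) where

  V : Set
  V = Fin (n G)

  I : Set
  I = IVert G

  -- The vertex v_x of the triangle T_v lying on the edge vx has home v and away x.
  home away : I → V
  home = proj₁
  away a = proj₁ (proj₂ a)

  IVert-≡ : {a b : I} → home a ≡ home b → away a ≡ away b → a ≡ b
  IVert-≡ {v , x , p} {_ , _ , q} refl refl = cong (λ r → v , x , r) (T-irrelevant p q)

  Adj-sym : {v x : V} → T (Adj G v x) → T (Adj G x v)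
  Adj-sym = adj-sym G

  Adj-irrefl : {v : V} → ¬ T (Adj G v v)
  Adj-irrefl {v} = subst T (irref G v)

  IAdj-cases : (a b : I) → T (IAdj G a b) →
    (home a ≡ home b × away a ≢ away b) ⊎ (home b ≡ away a × away b ≡ home a)
  IAdj-cases (v , x , _) (w , y , _) adj with v Fin.≟ w | x Fin.≟ y | w Fin.≟ x | y Fin.≟ v
  ... | yes v≡w | no x≢y | _ | _ = inj₁ (v≡w , x≢y)
  ... | _ | _ | yes w≡x | yes y≡v = inj₂ (w≡x , y≡v)
  ... | yes _ | yes _ | yes _ | no _ = ⊥-elim adj
  ... | yes _ | yes _ | no _ | _ = ⊥-elim adj
  ... | no _ | _ | yes _ | no _ = ⊥-elim adj
  ... | no _ | _ | no _ | _ = ⊥-elim adj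

  triangle-edge : (a b : I) → home a ≡ home b → away a ≢ away b → T (IAdj G a b)
  triangle-edge (v , x , _) (w , y , _) v≡w x≢y with v Fin.≟ w | x Fin.≟ y
  ... | yes _ | no _ = _
  ... | no v≢w | _ = ⊥-elim (v≢w v≡w)
  ... | yes _ | yes x≡y = ⊥-elim (x≢y x≡y)

  link-edge : (a b : I) → home b ≡ away a → away b ≡ home a → T (IAdj G a b)
  link-edge (v , x , _) (w , y , _) w≡x y≡v with w Fin.≟ x | y Fin.≟ v
  ... | yes _ | yes _ = subst T (sym (∨-zeroʳ _)) _
  ... | no w≢x | _ = ⊥-elim (w≢x w≡x)
  ... | _ | no y≢v = ⊥-elim (y≢v y≡v)

  IAdj-sym : (a b : I) → T (IAdj G a b) → T (IAdj G b a)
  IAdj-sym a b adj with IAdj-cases a b adj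
  ... | inj₁ (va≡vb , xa≢xb) = triangle-edge b a (sym va≡vb) (xa≢xb ∘ sym)
  ... | inj₂ (vb≡xa , xb≡va) = link-edge b a (sym xb≡va) (sym vb≡xa)

  -- c has a single neighbour outside its triangle, namely its mate.
  one-in-triangle : (p c s : I) → T (IAdj G p c) → T (IAdj G c s) → p ≢ s →
    (home p ≡ home c × away p ≢ away c) ⊎ (home s ≡ home c × away s ≢ away c)
  one-in-triangle p c s pc cs p≢s with IAdj-cases p c pc | IAdj-cases c s cs
  ... | inj₁ (vp≡vc , xp≢xc) | _ = inj₁ (vp≡vc , xp≢xc)
  ... | inj₂ _ | inj₁ (vc≡vs , xc≢xs) = inj₂ (sym vc≡vs , xc≢xs ∘ sym)
  ... | inj₂ (vc≡xp , xc≡vp) | inj₂ (vs≡xc , xs≡vc) =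
    ⊥-elim (p≢s (IVert-≡ (trans (sym xc≡vp) (sym vs≡xc)) (trans (sym vc≡xp) (sym xs≡vc))))

  private
    module Nb (v : V) = Neighbours (HasDegree⇒Neighbours {E = Adj G} (cubic v))

  nbr : V → Fin 3 → V
  nbr = Nb.nbr

  corner : V → Fin 3 → I
  corner v i = v , nbr v i , Nb.nbr-adj v i

  mate : I → I
  mate (v , x , vx) = x , v , Adj-sym vx

  index : I → Fin 3
  index (v , _ , vx) = proj₁ (Nb.nbr-complete v vx)

  corner-index : (a : I) → corner (home a) (index a) ≡ a
  corner-index (v , _ , vx) = IVert-≡ refl (proj₂ (Nb.nbr-complete v vx))

  corner-home : (a : I) {v : V} → home a ≡ v → corner v (index a) ≡ a
  corner-home a refl = corner-index a

  index-corner : (v : V) (i : Fin 3) → index (corner v i) ≡ i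
  index-corner v i = Nb.nbr-injective v (proj₂ (Nb.nbr-complete v (Nb.nbr-adj v i)))

  index-injective : {a b : I} → home a ≡ home b → index a ≡ index b → a ≡ b
  index-injective {a} {b} va≡vb ia≡ib =
    trans (sym (corner-index a)) (trans (cong₂ corner va≡vb ia≡ib) (corner-index b))

  corner-injective : {v : V} {i j : Fin 3} → corner v i ≡ corner v j → i ≡ j
  corner-injective {v} eq = Nb.nbr-injective v (cong away eq)

  I-neighbours : I → List I
  I-neighbours a = corner (home a) (proj₁ (others (index a))) ∷ corner (home a) (proj₂ (others (index a))) ∷ mate a ∷ []

  I-degree : (a : I) → HasDegree (IAdj G) a 3
  I-degree a = I-neighbours a , unique , (λ c → mk⇔ (∈⇒adj c) (adj⇒∈ c)) , refl
    where
    v = home a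
    i = index a
    j = proj₁ (others i)
    k = proj₂ (others i)
    corner≢mate : (l : Fin 3) → corner v l ≢ mate a
    corner≢mate l eq = Adj-irrefl (subst (λ x → T (Adj G v x)) (sym (cong home eq)) (proj₂ (proj₂ a)))
    away≢ : (l : Fin 3) → l ≢ i → nbr v l ≢ away a
    away≢ l l≢i eq = l≢i (corner-injective (trans (IVert-≡ refl eq) (sym (corner-index a))))
    unique : Unique (I-neighbours a)
    unique = ((others-≢ i ∘ corner-injective) ∷ corner≢mate j ∷ []) ∷ (corner≢mate k ∷ []) ∷ [] ∷ []
    ∈⇒adj : (c : I) → c ∈ I-neighbours a → T (IAdj G a c)
    ∈⇒adj c (here refl) = triangle-edge a c refl (away≢ j (others-≢ˡ i) ∘ sym)
    ∈⇒adj c (there (here refl)) = triangle-edge a c refl (away≢ k (others-≢ʳ i) ∘ sym)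
    ∈⇒adj c (there (there (here refl))) = link-edge a c refl refl
    adj⇒∈ : (c : I) → T (IAdj G a c) → c ∈ I-neighbours a
    adj⇒∈ c ac with IAdj-cases a c ac
    ... | inj₂ (vc≡xa , xc≡va) = there (there (here (IVert-≡ vc≡xa xc≡va)))
    ... | inj₁ (va≡vc , xa≢xc) with others-complete i (index c) (xa≢xc ∘ sym ∘ cong away ∘ index-injective (sym va≡vc))
    ...   | inj₁ ic≡j = here (index-injective (sym va≡vc) (trans ic≡j (sym (index-corner v j))))
    ...   | inj₂ ic≡k = there (here (index-injective (sym va≡vc) (trans ic≡k (sym (index-corner v k)))))

  triangle-size : {u : V} {cs : List I} → Unique cs → All (λ c → home c ≡ u) cs → length cs ≤ 3
  triangle-size {u} {cs} cs! homes = subst (length cs ≤_) (proj₂ (proj₂ (proj₂ (cubic u))))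
    (length≤-by-injection away
      (AllPairs-restrict (λ vc vc′ c≢c′ → c≢c′ ∘ IVert-≡ (trans vc (sym vc′))) homes cs!)
      λ {c} c∈ → Equivalence.from (proj₁ (proj₂ (proj₂ (cubic u))) (away c))
                   (subst (λ v → T (Adj G v (away c))) (All.lookup homes c∈) (proj₂ (proj₂ c))))

  corner-edge : (v : V) {i j : Fin 3} → i ≢ j → T (IAdj G (corner v i) (corner v j))
  corner-edge v {i} {j} i≢j = triangle-edge (corner v i) (corner v j) refl (i≢j ∘ Nb.nbr-injective v)

  nbr-degree : (v : V) → HasDegree (Adj G) v 3
  nbr-degree v = Neighbours⇒HasDegree (HasDegree⇒Neighbours {E = Adj G} (cubic v))

  module Oriented (F : I → I → Bool) (F-orientation : IsOrientation (IAdj G) F) where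

    D : V → V → Bool
    D = projection G F

    D-mate : (a : I) → D (home a) (away a) ≡ F a (mate a)
    D-mate (v , x , vx) with T? (Adj G v x)
    ... | yes vx′ = cong (λ p → F (v , x , p) (x , v , Adj-sym p)) (T-irrelevant vx′ vx)
    ... | no ¬vx = ⊥-elim (¬vx vx)

    D⇒Adj : {v x : V} → T (D v x) → T (Adj G v x)
    D⇒Adj {v} {x} Dvx with T? (Adj G v x)
    ... | yes vx = vx

    D-orientation : IsOrientation (Adj G) D
    D-orientation = (λ _ _ → D⇒Adj) , λ v x vx →
      let a = (v , x , vx)
          mate-mate = cong (F (mate a)) (IVert-≡ {mate (mate a)} {a} refl refl)
      in subst₂ (λ b b′ → (T b × ¬ T b′) ⊎ (T b′ × ¬ T b)) (sym (D-mate a)) (sym (trans (D-mate (mate a)) mate-mate))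
           (proj₂ F-orientation a (mate a) (link-edge a (mate a) refl refl))

    module OF = Orientation F-orientation (λ {a} {b} → IAdj-sym a b)
    module OD = Orientation D-orientation Adj-sym

    opaque
      outF : I → ℕ
      outF a = OF.outdeg {a} (I-degree a)

      outD : V → ℕ
      outD v = OD.outdeg {v} (nbr-degree v)

      outF≡outdeg : (a : I) → outF a ≡ OF.outdeg {a} (I-degree a)
      outF≡outdeg a = refl

      outD≡outdeg : (v : V) → outD v ≡ OD.outdeg {v} (nbr-degree v)
      outD≡outdeg v = refl

    outF-corner : (v : V) (i : Fin 3) → let c = corner v i in
      outF c ≡ indicator (F c (corner v (proj₁ (others i)))) + (indicator (F c (corner v (proj₂ (others i))))
                 + (indicator (D v (nbr v i)) + 0))
    outF-corner v i = begin
      outF c ≡⟨ trans (outF≡outdeg c) (length-filter-T? (F c) (I-neighbours c)) ⟩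
      sum (map (indicator ∘ F c) (I-neighbours c))
        ≡⟨ cong (λ l → sum (map (indicator ∘ F c) (neighbours-at l))) (index-corner v i) ⟩
      sum (map (indicator ∘ F c) (neighbours-at i))
        ≡⟨ cong (λ b → x + (y + (indicator b + 0))) (D-mate c) ⟨
      x + (y + (indicator (D v (nbr v i)) + 0)) ∎
      where
      open ≡-Reasoning
      c = corner v i
      x = indicator (F c (corner v (proj₁ (others i))))
      y = indicator (F c (corner v (proj₂ (others i))))
      neighbours-at : Fin 3 → List I
      neighbours-at l = corner v (proj₁ (others l)) ∷ corner v (proj₂ (others l)) ∷ mate c ∷ []

    -- Every arc of T_v is counted once, and the arcs leaving T_v are those leaving v in D.
    triangle-outdeg-sum : (v : V) → outF (corner v 0F) + outF (corner v 1F) + outF (corner v 2F) ≡ 3 + outD v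
    triangle-outdeg-sum v = begin
      outF (c 0F) + outF (c 1F) + outF (c 2F)
        ≡⟨ cong₂ _+_ (cong₂ _+_ (outF-corner v 0F) (outF-corner v 1F)) (outF-corner v 2F) ⟩
      (a 0F 1F + (a 0F 2F + (d 0F + 0))) + (a 1F 0F + (a 1F 2F + (d 1F + 0))) + (a 2F 0F + (a 2F 1F + (d 2F + 0)))
        ≡⟨ regroup (a 0F 1F) (a 0F 2F) (d 0F) (a 1F 0F) (a 1F 2F) (d 1F) (a 2F 0F) (a 2F 1F) (d 2F) ⟩
      (a 0F 1F + a 1F 0F) + (a 0F 2F + a 2F 0F) + (a 1F 2F + a 2F 1F) + (d 0F + (d 1F + (d 2F + 0)))
        ≡⟨ cong (_+ (d 0F + (d 1F + (d 2F + 0))))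
             (cong₂ _+_ (cong₂ _+_ (pair 0F 1F λ ()) (pair 0F 2F λ ())) (pair 1F 2F λ ())) ⟩
      3 + (d 0F + (d 1F + (d 2F + 0)))
        ≡⟨ cong (3 +_) (trans (outD≡outdeg v) (length-filter-T? (D v) (tabulate (nbr v)))) ⟨
      3 + outD v ∎
      where
      open ≡-Reasoning
      c = corner v
      a : Fin 3 → Fin 3 → ℕ
      a i j = indicator (F (c i) (c j))
      d : Fin 3 → ℕ
      d i = indicator (D v (nbr v i))
      pair : (i j : Fin 3) → i ≢ j → a i j + a j i ≡ 1
      pair i j i≢j = OF.arc-indicators (corner-edge v i≢j)
      regroup : ∀ x₀₁ x₀₂ y₀ x₁₀ x₁₂ y₁ x₂₀ x₂₁ y₂ →
        (x₀₁ + (x₀₂ + (y₀ + 0))) + (x₁₀ + (x₁₂ + (y₁ + 0))) + (x₂₀ + (x₂₁ + (y₂ + 0))) ≡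
        (x₀₁ + x₁₀) + (x₀₂ + x₂₀) + (x₁₂ + x₂₁) + (y₀ + (y₁ + (y₂ + 0)))
      regroup = solve-∀

    F-arc⇒D : {a b : I} → T (F a b) → home a ≢ home b → T (D (home a) (home b))
    F-arc⇒D {a} {b} ab va≢vb with IAdj-cases a b (OF.arc⇒edge ab)
    ... | inj₁ (va≡vb , _) = ⊥-elim (va≢vb va≡vb)
    ... | inj₂ (vb≡xa , xb≡va) = subst T (sym (begin
      D (home a) (home b) ≡⟨ cong (D (home a)) vb≡xa ⟩
      D (home a) (away a) ≡⟨ D-mate a ⟩
      F a (mate a)        ≡⟨ cong (F a) (IVert-≡ (sym vb≡xa) (sym xb≡va)) ⟩
      F a b               ∎)) ab
      where open ≡-Reasoning

    module _ {a b : I} (va≢vb : home a ≢ home b) where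

      private
        module C (P : DPath F a b) = Contraction Fin._≟_ {A = F} {B = D} home F-arc⇒D va≢vb P

      contract : DPath F a b → DPath D (home a) (home b)
      contract = C.contract

      contract-mid : (P : DPath F a b) {u : V} → u ∈ mids (contract P) → ∃ λ c → c ∈ mids P × home c ≡ u
      contract-mid P u∈ with c , c∈ , refl ← ∈-map⁻ home (C.contract-mids⊆ P u∈) with ∈-vertices⁻ P c∈
      ... | inj₁ refl = ⊥-elim (source∉mids (contract P) u∈)
      ... | inj₂ (inj₁ c∈mids) = c , c∈mids , refl
      ... | inj₂ (inj₂ refl) = ⊥-elim (target∉mids (contract P) u∈)

      triangle-partner : (P : DPath F a b) {c : I} → c ∈ mids P → home c ≢ home a → home c ≢ home b →
        ∃ λ c′ → c′ ∈ mids P × home c′ ≡ home c × away c′ ≢ away c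
      triangle-partner P {c} c∈ c≉a c≉b with interior-step P c∈
      ... | record { pred = p ; succ = s ; pred∈ = p∈ ; succ∈ = s∈ ; pred-arc = pc ; succ-arc = cs ; pred≢succ = p≢s }
        with one-in-triangle p c s (OF.arc⇒edge pc) (OF.arc⇒edge cs) p≢s | p∈ | s∈
      ... | inj₁ (vp≡vc , xp≢xc) | inj₂ p∈P | _ = p , p∈P , vp≡vc , xp≢xc
      ... | inj₁ (vp≡vc , _) | inj₁ refl | _ = ⊥-elim (c≉a (sym vp≡vc))
      ... | inj₂ (vs≡vc , xs≢xc) | _ | inj₁ s∈P = s , s∈P , vs≡vc , xs≢xc
      ... | inj₂ (vs≡vc , _) | _ | inj₂ refl = ⊥-elim (c≉b (sym vs≡vc))

      private
        partner : (P : DPath F a b) {c : I} → c ∈ mids P → home c ∈ mids (contract P) →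
          ∃ λ c′ → c′ ∈ mids P × home c′ ≡ home c × away c′ ≢ away c
        partner P c∈ vc∈ = triangle-partner P c∈
          (λ eq → source∉mids (contract P) (subst (_∈ _) eq vc∈))
          (λ eq → target∉mids (contract P) (subst (_∈ _) eq vc∈))

        away≢⇒≢ : {x y : I} → away x ≢ away y → x ≢ y
        away≢⇒≢ x≉y = x≉y ∘ cong away

      -- Two disjoint paths through the same triangle would use four of its three corners.
      contract-disjoint : (P Q : DPath F a b) → Disjoint (mids P) (mids Q) →
        Disjoint (mids (contract P)) (mids (contract Q))
      contract-disjoint P Q P#Q (u∈P , u∈Q)
        with c , c∈ , refl ← contract-mid P u∈P | d , d∈ , vd≡vc ← contract-mid Q u∈Q
        with c′ , c′∈ , vc′≡vc , xc′≢xc ← partner P c∈ u∈P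
           | d′ , d′∈ , vd′≡vd , xd′≢xd ← partner Q d∈ (subst (_∈ _) (sym vd≡vc) u∈Q)
        with s≤s (s≤s (s≤s ())) ← triangle-size {cs = c ∷ c′ ∷ d ∷ d′ ∷ []}
          ((away≢⇒≢ (xc′≢xc ∘ sym) ∷ Disjoint⇒≢ P#Q c∈ d∈ ∷ Disjoint⇒≢ P#Q c∈ d′∈ ∷ [])
            ∷ (Disjoint⇒≢ P#Q c′∈ d∈ ∷ Disjoint⇒≢ P#Q c′∈ d′∈ ∷ [])
            ∷ (away≢⇒≢ (xd′≢xd ∘ sym) ∷ [])
            ∷ [] ∷ [])
          (refl ∷ vc′≡vc ∷ vd≡vc ∷ trans vd′≡vd vd≡vc ∷ [])

      contract-direct : (P : DPath F a b) → mids (contract P) ≡ [] →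
        ∃₂ λ c c′ → Consecutive (vertices P) c c′ ×
          home c ≡ home a × away c ≡ home b × home c′ ≡ home b × away c′ ≡ home a
      contract-direct P mids≡[] with c , c′ , cc′ , refl , refl ← C.contract-direct P mids≡[]
        with IAdj-cases c c′ (OF.arc⇒edge (Linked⇒Consecutive⇒ (walk P) cc′))
      ... | inj₁ (vc≡vc′ , _) = ⊥-elim (va≢vb vc≡vc′)
      ... | inj₂ (vc′≡xc , xc′≡vc) = c , c′ , cc′ , refl , sym vc′≡xc , refl , xc′≡vc

      private
        shared-at-source : (P Q : DPath F a b) → Disjoint (mids P) (mids Q) →
          {c : I} → c ∈ vertices P → c ∈ vertices Q → home c ≡ home a → c ≡ a
        shared-at-source P Q P#Q c∈P c∈Q vc≡va with shared-vertex P Q P#Q c∈P c∈Q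
        ... | inj₁ c≡a = c≡a
        ... | inj₂ refl = ⊥-elim (va≢vb (sym vc≡va))

        shared-at-target : (P Q : DPath F a b) → Disjoint (mids P) (mids Q) →
          {c : I} → c ∈ vertices P → c ∈ vertices Q → home c ≡ home b → c ≡ b
        shared-at-target P Q P#Q c∈P c∈Q vc≡vb with shared-vertex P Q P#Q c∈P c∈Q
        ... | inj₁ refl = ⊥-elim (va≢vb vc≡vb)
        ... | inj₂ c≡b = c≡b

      contract-direct-unique : (P Q : DPath F a b) → Disjoint (mids P) (mids Q) →
        mids (contract P) ≡ [] → mids (contract Q) ≡ [] → mids P ≡ mids Q
      contract-direct-unique P Q P#Q P↦[] Q↦[]
        with c , c′ , cc′ , vc , xc , vc′ , xc′ ← contract-direct P P↦[]
           | d , d′ , dd′ , vd , xd , vd′ , xd′ ← contract-direct Q Q↦[]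
        with refl ← IVert-≡ {c} {d} (trans vc (sym vd)) (trans xc (sym xd))
           | refl ← IVert-≡ {c′} {d′} (trans vc′ (sym vd′)) (trans xc′ (sym xd′))
        with refl ← shared-at-source P Q P#Q (Consecutive-∈ˡ cc′) (Consecutive-∈ˡ dd′) vc
           | refl ← shared-at-target P Q P#Q (Consecutive-∈ʳ cc′) (Consecutive-∈ʳ dd′) vc′
        = trans (direct-step⇒mids≡[] P cc′) (sym (direct-step⇒mids≡[] Q dd′))

      contract-distinct : (P Q : DPath F a b) → mids P ≢ mids Q → Disjoint (mids P) (mids Q) →
        mids (contract P) ≢ mids (contract Q)
      contract-distinct P Q P≢Q P#Q eq with mids (contract P) in P↦
      ... | u ∷ _ = contract-disjoint P Q P#Q (subst (u ∈_) (sym P↦) (here refl) , subst (u ∈_) eq (here refl))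
      ... | [] = P≢Q (contract-direct-unique P Q P#Q P↦ (sym eq))

      contract-IntDisjoint : {Ps : List (DPath F a b)} → IntDisjoint Ps → IntDisjoint (map contract Ps)
      contract-IntDisjoint = AllPairsₚ.map⁺ ∘ AllPairs.map λ {P} {Q} (P≢Q , P#Q) →
        contract-distinct P Q P≢Q P#Q , contract-disjoint P Q P#Q

    -- The κ-values of a cross full pair survive contraction, and they pin down the out-degrees.
    cross-full : {a b : I} → home a ≢ home b → Full (IAdj G) F a b →
      Full (Adj G) D (home a) (home b) × outF a ≡ outD (home a) × outF b ≡ outD (home b)
    cross-full {a} {b} va≢vb full =
      OD.Linkage⇒Full (nbr-degree (home a)) (nbr-degree (home b)) va≢vb ℒD , outdeg-a , outdeg-b
      where
      open ≡-Reasoning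
      ℒ = OF.Full⇒Linkage (I-degree a) (I-degree b) full
      ℒD : OD.Linkage (home a) (home b) 3
      ℒD = record
        { forward = map (contract va≢vb) (OF.forward ℒ)
        ; backward = map (contract (va≢vb ∘ sym)) (OF.backward ℒ)
        ; forward# = contract-IntDisjoint va≢vb (OF.forward# ℒ)
        ; backward# = contract-IntDisjoint (va≢vb ∘ sym) (OF.backward# ℒ)
        ; total = trans (cong₂ _+_ (length-map _ (OF.forward ℒ)) (length-map _ (OF.backward ℒ))) (OF.total ℒ)
        }
      outdeg-a : outF a ≡ outD (home a)
      outdeg-a = begin
        outF a                 ≡⟨ outF≡outdeg a ⟩
        OF.outdeg (I-degree a) ≡⟨ OF.Linkage-outdeg (I-degree a) ℒ ⟨
        length (OF.forward ℒ)  ≡⟨ length-map _ (OF.forward ℒ) ⟨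
        length (OD.forward ℒD) ≡⟨ OD.Linkage-outdeg (nbr-degree (home a)) ℒD ⟩
        OD.outdeg (nbr-degree (home a)) ≡⟨ outD≡outdeg (home a) ⟨
        outD (home a)          ∎
      outdeg-b : outF b ≡ outD (home b)
      outdeg-b = begin
        outF b                  ≡⟨ outF≡outdeg b ⟩
        OF.outdeg (I-degree b)  ≡⟨ OF.Linkage-outdeg (I-degree b) (OF.Linkage-swap ℒ) ⟨
        length (OF.backward ℒ)  ≡⟨ length-map _ (OF.backward ℒ) ⟨
        length (OD.backward ℒD) ≡⟨ OD.Linkage-outdeg (nbr-degree (home b)) (OD.Linkage-swap ℒD) ⟩
        OD.outdeg (nbr-degree (home b)) ≡⟨ outD≡outdeg (home b) ⟨
        outD (home b)           ∎

    full-outdeg-sum : {a b : I} → Full (IAdj G) F a b → outF a + outF b ≡ 3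
    full-outdeg-sum {a} {b} full =
      trans (cong₂ _+_ (outF≡outdeg a) (outF≡outdeg b)) (OF.Full⇒outdeg-sum (I-degree a) (I-degree b) full)

    index-SameUPair : {v : V} {a b a′ b′ : I} → All (λ c → home c ≡ v) (a ∷ b ∷ a′ ∷ b′ ∷ []) →
      SameUPair (index a , index b) (index a′ , index b′) → SameUPair (a , b) (a′ , b′)
    index-SameUPair (va ∷ vb ∷ va′ ∷ vb′ ∷ []) (inj₁ (ia≡ia′ , ib≡ib′)) =
      inj₁ (index-injective (trans va (sym va′)) ia≡ia′ , index-injective (trans vb (sym vb′)) ib≡ib′)
    index-SameUPair (va ∷ vb ∷ va′ ∷ vb′ ∷ []) (inj₂ (ia≡ib′ , ib≡ia′)) =
      inj₂ (index-injective (trans va (sym vb′)) ia≡ib′ , index-injective (trans vb (sym va′)) ib≡ia′)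

    module _ (v : V) where

      InTriangle : I × I → Set
      InTriangle (a , b) = Full (IAdj G) F a b × home a ≡ v × home b ≡ v

      Complementary : Fin 3 → Set
      Complementary k = outF (corner v (proj₁ (others k))) + outF (corner v (proj₂ (others k))) ≡ 3

      third-corner : I × I → Fin 3
      third-corner (a , b) = third (index a) (index b)

      third-corner-SameUPair : {p : I × I} → InTriangle p →
        SameUPair (index (proj₁ p) , index (proj₂ p)) (others (third-corner p))
      third-corner-SameUPair {a , b} (full , va , vb) =
        third-others (index a) (index b) (proj₁ full ∘ index-injective (trans va (sym vb)))

      third-corner-complementary : {p : I × I} → InTriangle p → Complementary (third-corner p)
      third-corner-complementary {a , b} inT@(full , va , vb) with third-corner-SameUPair inT
      ... | inj₁ (ia≡ , ib≡) = subst₂ (λ i j → outF (corner v i) + outF (corner v j) ≡ 3) ia≡ ib≡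
              (trans (cong₂ _+_ (cong outF (corner-home a va)) (cong outF (corner-home b vb)))
                (full-outdeg-sum full))
      ... | inj₂ (ia≡ , ib≡) = subst₂ (λ i j → outF (corner v i) + outF (corner v j) ≡ 3) ib≡ ia≡
              (trans (cong₂ _+_ (cong outF (corner-home b vb)) (cong outF (corner-home a va)))
                (trans (+-comm (outF b) (outF a)) (full-outdeg-sum full)))

      not-all-complementary : ¬ (Complementary 0F × Complementary 1F × Complementary 2F)
      not-all-complementary (c₁₂ , c₀₂ , c₀₁) =
        three-pair-sums≢3 (outF (corner v 0F)) (outF (corner v 1F)) (outF (corner v 2F)) c₀₁ c₀₂ c₁₂

      triangle-full-pairs : {ps : List (I × I)} → AllPairs (λ p q → ¬ SameUPair p q) ps →
        All InTriangle ps → length ps ≤ 2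
      triangle-full-pairs ps≉ ps-in = ≤-trans
        (length≤-by-injection third-corner (AllPairs-restrict injective ps-in ps≉)
          λ p∈ → ∈-filter⁺ complementary? (∈-allFin _) (third-corner-complementary (All.lookup ps-in p∈)))
        (length-filter-allFin3≤2 complementary? not-all-complementary)
        where
        complementary? : Decidable Complementary
        complementary? k = _ ℕ.≟ 3
        injective : {p q : I × I} → InTriangle p → InTriangle q → ¬ SameUPair p q → third-corner p ≢ third-corner q
        injective {a , b} {a′ , b′} inT@(_ , va , vb) inT′@(_ , va′ , vb′) p≉q eq =
          p≉q (index-SameUPair (va ∷ vb ∷ va′ ∷ vb′ ∷ [])
            (SameUPair-trans (third-corner-SameUPair inT)
              (SameUPair-sym (subst (λ t → SameUPair _ (others t)) (sym eq) (third-corner-SameUPair inT′)))))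

    Balanced : V → Fin 3 → Set
    Balanced u i = outF (corner u i) ≡ outD u

    balanced? : (u : V) → Decidable (Balanced u)
    balanced? u i = outF (corner u i) ℕ.≟ outD u

    not-all-balanced : (u : V) → ¬ (Balanced u 0F × Balanced u 1F × Balanced u 2F)
    not-all-balanced u (b₀ , b₁ , b₂) = triple≢3+ (outD u) (begin
      outD u + outD u + outD u ≡⟨ cong₂ _+_ (cong₂ _+_ b₀ b₁) b₂ ⟨
      outF (corner u 0F) + outF (corner u 1F) + outF (corner u 2F) ≡⟨ triangle-outdeg-sum u ⟩
      3 + outD u ∎)
      where open ≡-Reasoning

    module _ (v w : V) where

      Across : I × I → Set
      Across (a , b) = Full (IAdj G) F a b × home a ≢ home b × SameUPair (home a , home b) (v , w)

      orient : I × I → I × I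
      orient (a , b) with home a Fin.≟ v
      ... | yes _ = a , b
      ... | no _ = b , a

      orient-SameUPair : (p : I × I) → SameUPair p (orient p)
      orient-SameUPair (a , b) with home a Fin.≟ v
      ... | yes _ = inj₁ (refl , refl)
      ... | no _ = inj₂ (refl , refl)

      orient-homes : {p : I × I} → Across p → home (proj₁ (orient p)) ≡ v × home (proj₂ (orient p)) ≡ w
      orient-homes {a , b} (_ , va≢vb , homes) with home a Fin.≟ v | homes
      ... | yes _ | inj₁ (va≡v , vb≡w) = va≡v , vb≡w
      ... | yes va≡v | inj₂ (_ , vb≡v) = ⊥-elim (va≢vb (trans va≡v (sym vb≡v)))
      ... | no va≢v | inj₁ (va≡v , _) = ⊥-elim (va≢v va≡v)
      ... | no _ | inj₂ (va≡w , vb≡v) = vb≡v , va≡w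

      corner-indices : I × I → Fin 3 × Fin 3
      corner-indices p = index (proj₁ (orient p)) , index (proj₂ (orient p))

      corner-indices-balanced : {p : I × I} → Across p →
        Balanced v (proj₁ (corner-indices p)) × Balanced w (proj₂ (corner-indices p))
      corner-indices-balanced {p@(a , b)} across@(full , va≢vb , _)
        with a′-balanced , b′-balanced ← SameUPair-both {P = λ c → outF c ≡ outD (home c)} (orient-SameUPair p)
               (proj₁ (proj₂ (cross-full va≢vb full))) (proj₂ (proj₂ (cross-full va≢vb full)))
        with va′ , vb′ ← orient-homes across =
        balanced (proj₁ (orient p)) va′ a′-balanced , balanced (proj₂ (orient p)) vb′ b′-balanced
        where
        balanced : {u : V} (c : I) → home c ≡ u → outF c ≡ outD (home c) → Balanced u (index c)
        balanced c refl c-balanced = trans (cong outF (corner-index c)) c-balanced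

      corner-indices-injective : {p q : I × I} → Across p → Across q → ¬ SameUPair p q →
        corner-indices p ≢ corner-indices q
      corner-indices-injective {p} {q} across-p across-q p≉q eq = p≉q (SameUPair-trans
        (subst (SameUPair p) orient-p≡orient-q (orient-SameUPair p)) (SameUPair-sym (orient-SameUPair q)))
        where
        orient-p≡orient-q : orient p ≡ orient q
        orient-p≡orient-q = cong₂ _,_
          (index-injective (trans (proj₁ (orient-homes across-p)) (sym (proj₁ (orient-homes across-q)))) (cong proj₁ eq))
          (index-injective (trans (proj₂ (orient-homes across-p)) (sym (proj₂ (orient-homes across-q)))) (cong proj₂ eq))

      cross-full-pairs : {ps : List (I × I)} → AllPairs (λ p q → ¬ SameUPair p q) ps → All Across ps → length ps ≤ 4
      cross-full-pairs {ps} ps≉ ps-across = begin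
        length ps ≤⟨ length≤-by-injection corner-indices (AllPairs-restrict corner-indices-injective ps-across ps≉) into ⟩
        length (cartesianProduct (balanced-in v) (balanced-in w)) ≡⟨ length-cartesianProduct (balanced-in v) (balanced-in w) ⟩
        length (balanced-in v) * length (balanced-in w) ≤⟨ *-mono-≤ (at-most-two v) (at-most-two w) ⟩
        4 ∎
        where
        open ≤-Reasoning
        balanced-in : V → List (Fin 3)
        balanced-in u = filter (balanced? u) (allFin 3)
        at-most-two : (u : V) → length (balanced-in u) ≤ 2
        at-most-two u = length-filter-allFin3≤2 (balanced? u) (not-all-balanced u)
        into : {p : I × I} → p ∈ ps → corner-indices p ∈ cartesianProduct (balanced-in v) (balanced-in w)
        into {p} p∈ = ∈-cartesianProduct⁺ {xs = balanced-in v} {ys = balanced-in w}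
          (∈-filter⁺ (balanced? v) (∈-allFin (proj₁ (corner-indices p))) (proj₁ balanced))
          (∈-filter⁺ (balanced? w) (∈-allFin (proj₂ (corner-indices p))) (proj₂ balanced))
          where balanced = corner-indices-balanced (All.lookup ps-across p∈)

    SameHome : I × I → Set
    SameHome (a , b) = home a ≡ home b

    same-home? : Decidable SameHome
    same-home? (a , b) = home a Fin.≟ home b

    module _ {L : List (I × I)} (L-pairs : FullPairList (IAdj G) F L) where

      within-triangles : length (filter same-home? L) ≤ n G * 2
      within-triangles = subst (λ m → length (filter same-home? L) ≤ m * 2) (length-tabulate {n = n G} id)
        (length≤-by-cover (λ p v → home (proj₁ p) ≡ v) (λ p v → home (proj₁ p) Fin.≟ v) 2
          (allFin (n G)) (filter same-home? L)
          (λ _ → ∈-allFin _)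
          λ v → triangle-full-pairs v (AllPairsₚ.filter⁺ _ (AllPairsₚ.filter⁺ same-home? (proj₁ L-pairs)))
                  (All.map (λ (full , same , at-v) → full , at-v , trans (sym same) at-v)
                    (All-filter-filter same-home? (λ p → home (proj₁ p) Fin.≟ v) (proj₂ L-pairs))))

      across-triangles : {C : ℕ} → ExactlyFullPairs (Adj G) D C → length (filter (∁? same-home?) L) ≤ C * 4
      across-triangles (LD , _ , LD-complete , refl) =
        length≤-by-cover (λ p q → SameUPair (home (proj₁ p) , home (proj₂ p)) q) (λ p → SameUPair? Fin._≟_ _) 4
          LD (filter (∁? same-home?) L)
          (λ p∈ → let (p∈L , va≢vb) = ∈-filter⁻ (∁? same-home?) p∈ in
                  LD-complete _ _ (proj₁ (cross-full va≢vb (All.lookup (proj₂ L-pairs) p∈L))))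
          λ (v , w) → cross-full-pairs v w (AllPairsₚ.filter⁺ _ (AllPairsₚ.filter⁺ (∁? same-home?) (proj₁ L-pairs)))
                  (All-filter-filter (∁? same-home?) (λ p → SameUPair? Fin._≟_ _ (v , w)) (proj₂ L-pairs))

lemma3p4 : (G : SimpleGraph) → Cubic G →
    (F : IVert G → IVert G → Bool) → IsOrientation (IAdj G) F →
    (C : ℕ) → ExactlyFullPairs (Adj G) (projection G F) C →
    (L : List (IVert G × IVert G)) → FullPairList (IAdj G) F L →
    length L ≤ 4 * C + 2 * n G
lemma3p4 G cubic F F-orientation C D-pairs L L-pairs = begin
  length L
    ≡⟨ length-filter+length-filter-∁ same-home? L ⟨
  length (filter same-home? L) + length (filter (∁? same-home?) L)
    ≤⟨ +-mono-≤ (within-triangles L-pairs) (across-triangles L-pairs D-pairs) ⟩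
  n G * 2 + C * 4
    ≡⟨ trans (+-comm (n G * 2) (C * 4)) (cong₂ _+_ (*-comm C 4) (*-comm (n G) 2)) ⟩
  4 * C + 2 * n G ∎
  where
  open ≤-Reasoning
  open Inflation G cubic
  open Oriented F F-orientation
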